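{- There is no finite simple graph $G$ with a planar embedding satisfying all of the following: (1) $G$ is 2-connected and every face of the embedding has size at most 6; (2) the outer face of the embedding is bounded by a quadrilateral on four vertices $x,y,z,w$ in this cyclic order, and $x$ and $y$ have degree 2; (3) every vertex in $V(G)\setminus\{x,y\}$ has degree 3.
   Context: All graphs are finite, simple and undirected. The size of a face is the number of edges on its boundary. The outer face of a planar embedding is its unique unbounded face. -}

module Defs where

open import Data.Nat using (ℕ; zero; suc; _+_; _*_; _≤_; _<ᵇ_; _≡ᵇ_; _≤ᵇ_)
open import Data.Bool using (Bool; true; false; _∧_; _∨_)
open import Data.Fin using (Fin; zero; suc; toℕ)
open import Data.Fin.Properties using () renaming (_≟_ to _≟F_)
open import Data.List using (List; []; _∷_; length; filter; allFin; map; concatMap; upTo)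
import Data.List as L
open import Data.Maybe using (Maybe; just; nothing; fromMaybe)
import Data.Maybe as M
open import Data.Product using (Σ; ∃; _×_; _,_; proj₁; proj₂)
open import Data.Unit using (⊤)
open import Relation.Nullary using (¬_; Dec)
open import Relation.Unary using (Decidable)
open import Relation.Binary.PropositionalEquality using (_≡_; _≢_)
open import Function.Definitions using (Injective)
import Data.Bool.ListAction

record Graph : Set₁ where
  field
    n       : ℕ
    Adj     : Fin n → Fin n → Set
    Adj-dec : ∀ u v → Dec (Adj u v)
    sym     : ∀ {u v} → Adj u v → Adj v u
    irrefl  : ∀ {u} → ¬ Adj u u

module _ (G : Graph) where
  open Graph G

  degree : Fin n → ℕ
  degree v = length (filter (Adj-dec v) (allFin n))

  data WalkIn (P : Fin n → Set) : Fin n → Fin n → Set where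
    here : ∀ {a} → P a → WalkIn P a a
    step : ∀ {a b c} → P a → Adj a b → WalkIn P b c → WalkIn P a c

  Connected : Set
  Connected = ∀ a b → WalkIn (λ _ → ⊤) a b

  TwoConnected : Set
  TwoConnected =
    (3 ≤ n) × Connected ×
    (∀ v a b → a ≢ v → b ≢ v → WalkIn (λ u → u ≢ v) a b)

inc : ∀ {m} → Fin m → Maybe (Fin m)
inc {suc zero} zero = nothing
inc {suc (suc m)} zero = just (suc zero)
inc {suc (suc m)} (suc i) = M.map suc (inc i)

csuc : ∀ {m} → Fin m → Fin m
csuc {suc m} i = fromMaybe zero (inc i)

-- Combinatorial embeddings (rotation systems) of a graph.
-- At each vertex v, rot v lists the neighbours of v in the cyclic
-- (clockwise) order of the embedding; it is a bijection
-- Fin (deg v) → N(v).  rev v i is the position of v in the rotation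
-- at the neighbour rot v i (uniquely determined by injectivity).

record RotationSystem (G : Graph) : Set where
  open Graph G
  field
    deg     : Fin n → ℕ
    rot     : (v : Fin n) → Fin (deg v) → Fin n
    rot-inj : ∀ v → Injective _≡_ _≡_ (rot v)
    rot-adj : ∀ v i → Adj v (rot v i)
    rot-sur : ∀ v u → Adj v u → ∃ λ i → rot v i ≡ u
    rev     : (v : Fin n) (i : Fin (deg v)) → Fin (deg (rot v i))
    rev-ok  : ∀ v i → rot (rot v i) (rev v i) ≡ v

  -- darts (directed edges) : dart (v , i) goes from v to rot v i
  Dart : Set
  Dart = Σ (Fin n) (λ v → Fin (deg v))

  tail : Dart → Fin n
  tail = proj₁

  -- face-tracing permutation: (u → v) ↦ (v → w), w the successor of u
  -- in the rotation at v
  φ : Dart → Dart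
  φ (v , i) = rot v i , csuc (rev v i)

  φ^ : ℕ → Dart → Dart
  φ^ zero d = d
  φ^ (suc k) d = φ^ k (φ d)

  darts : List Dart
  darts = concatMap (λ v → map (v ,_) (allFin (deg v))) (allFin n)

  numDarts : ℕ
  numDarts = length darts

  _≤D_ : Dart → Dart → Bool
  (u , i) ≤D (v , j) = (toℕ u <ᵇ toℕ v) ∨ ((toℕ u ≡ᵇ toℕ v) ∧ (toℕ i ≤ᵇ toℕ j))

  isFaceRep : Dart → Bool
  isFaceRep d = Data.Bool.ListAction.all (λ k → d ≤D φ^ k d) (upTo numDarts)

  numFaces : ℕ
  numFaces = length (L.filter (λ d → Data.Bool._≟_ (isFaceRep d) true) darts)
    where import Data.Bool

  FaceSize≤ : Dart → ℕ → Set
  FaceSize≤ d k = ∃ λ j → (1 ≤ j) × (j ≤ k) × (φ^ j d ≡ d)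

  -- genus 0 (Euler's formula V - E + F = 2, with 2E = #darts);
  -- for connected graphs this characterises planar (spherical) embeddings
  Planar : Set
  Planar = 2 * n + 2 * numFaces ≡ numDarts + 4

{-# OPTIONS --safe #-}
module Submission where

-- Build a ladder inward from the outer face: its first rung is x y, with rails x w and y z.
-- Given the last rung a b, with rails a e and b c and the edge c e, the face through c → b
-- runs c b a e f …. It cannot close after at most 4 steps, as b, a, e and f differ from c,
-- and a face c b a e f would make f a cut vertex: everything built so far, together with
-- c and e, can only be left through f. So that face is a hexagon c b a e f g; then c e is
-- the last rung and f, g, again of degree 3, are the ends of the new rails. The ladder thus
-- gains two vertices at every step, which is impossible in a finite graph.

open import Defs
open import Data.Nat using (ℕ; zero; suc; _+_; _≤_; _<_; z≤n; s≤s)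
open import Data.Nat.Properties using (≤-<-trans; n≤1+n; <⇒≱)
open import Data.Fin using (Fin; zero; suc)
open import Data.Fin.Properties using (cantor-schröder-bernstein; injective⇒≤)
open import Data.List using (List; []; _∷_; length; filter; allFin; lookup)
open import Data.List.Membership.Propositional using (_∈_; _∉_)
open import Data.List.Membership.Propositional.Properties using (∈-filter⁺; ∈-filter⁻; ∈-allFin; ∈-lookup)
open import Data.List.Membership.Setoid.Properties using (index-injective)
open import Data.List.Relation.Unary.Any using (here; there; index)
import Data.List.Relation.Unary.All as All
open import Data.List.Relation.Unary.All.Properties.Core using (¬Any⇒All¬)
open import Data.List.Relation.Unary.AllPairs using ([]; _∷_)
open import Data.List.Relation.Unary.Unique.Propositional using (Unique)
open import Data.List.Relation.Unary.Unique.Propositional.Properties using (filter⁺; allFin⁺)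
open import Data.Product using (Σ; ∃; _×_; _,_; proj₁; proj₂)
open import Data.Sum using (_⊎_; inj₁; inj₂)
open import Data.Empty using (⊥; ⊥-elim)
open import Relation.Nullary using (¬_; contradiction)
open import Relation.Binary.PropositionalEquality
  using (_≡_; _≢_; refl; sym; trans; cong; subst; setoid)
open import Function.Base using (_∘_)
open import Function.Definitions using (Injective)

lookup-injective : ∀ {A : Set} {xs : List A} → Unique xs → Injective _≡_ _≡_ (lookup xs)
lookup-injective {xs = _ ∷ _} _          {zero}  {zero}  _  = refl
lookup-injective {xs = _ ∷ _} (x∉ ∷ _)   {zero}  {suc j} eq = ⊥-elim (All.lookup x∉ (∈-lookup j) eq)
lookup-injective {xs = _ ∷ _} (x∉ ∷ _)   {suc i} {zero}  eq = ⊥-elim (All.lookup x∉ (∈-lookup i) (sym eq))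
lookup-injective {xs = _ ∷ _} (_ ∷ uniq) {suc i} {suc j} eq = cong suc (lookup-injective uniq eq)

∉⇒≢ : ∀ {A : Set} {u v : A} {xs} → v ∉ xs → u ∈ xs → v ≢ u
∉⇒≢ v∉ u∈ refl = v∉ u∈

module _ {m : ℕ} where

  csuc-fixfree₃ : m ≡ 3 → (i : Fin m) → csuc i ≢ i
  csuc-fixfree₃ refl zero ()
  csuc-fixfree₃ refl (suc zero) ()
  csuc-fixfree₃ refl (suc (suc zero)) ()

  csuc³≡id : m ≡ 3 → (i : Fin m) → csuc (csuc (csuc i)) ≡ i
  csuc³≡id refl zero = refl
  csuc³≡id refl (suc zero) = refl
  csuc³≡id refl (suc (suc zero)) = refl

  csuc-orbit₃ : m ≡ 3 → (i j : Fin m) → j ≡ i ⊎ j ≡ csuc i ⊎ j ≡ csuc (csuc i)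
  csuc-orbit₃ refl zero zero = inj₁ refl
  csuc-orbit₃ refl zero (suc zero) = inj₂ (inj₁ refl)
  csuc-orbit₃ refl zero (suc (suc zero)) = inj₂ (inj₂ refl)
  csuc-orbit₃ refl (suc zero) zero = inj₂ (inj₂ refl)
  csuc-orbit₃ refl (suc zero) (suc zero) = inj₁ refl
  csuc-orbit₃ refl (suc zero) (suc (suc zero)) = inj₂ (inj₁ refl)
  csuc-orbit₃ refl (suc (suc zero)) zero = inj₂ (inj₁ refl)
  csuc-orbit₃ refl (suc (suc zero)) (suc zero) = inj₂ (inj₂ refl)
  csuc-orbit₃ refl (suc (suc zero)) (suc (suc zero)) = inj₁ refl

  csuc²≡id : m ≡ 2 → (i : Fin m) → csuc (csuc i) ≡ i
  csuc²≡id refl zero = refl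
  csuc²≡id refl (suc zero) = refl

  csuc-orbit₂ : m ≡ 2 → (i j : Fin m) → j ≡ i ⊎ j ≡ csuc i
  csuc-orbit₂ refl zero zero = inj₁ refl
  csuc-orbit₂ refl zero (suc zero) = inj₂ refl
  csuc-orbit₂ refl (suc zero) zero = inj₂ refl
  csuc-orbit₂ refl (suc zero) (suc zero) = inj₁ refl

module _ (G : Graph) where
  open Graph G renaming (sym to Adj-sym)

  Adj⇒≢ : ∀ {u v} → Adj u v → u ≢ v
  Adj⇒≢ uv refl = irrefl uv

  closed⇒¬WalkIn : ∀ {P : Fin n → Set} {S s t} →
                   (∀ {u v} → u ∈ S → Adj u v → v ∈ S ⊎ ¬ P v) →
                   s ∉ S → t ∈ S → ¬ WalkIn G P s t
  closed⇒¬WalkIn closed s∉ t∈ (here _) = s∉ t∈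
  closed⇒¬WalkIn {S = S} closed s∉ t∈ (step {b = b} Ps sb walk) = closed⇒¬WalkIn closed b∉ t∈ walk
    where
    b∉ : b ∉ S
    b∉ b∈ with closed b∈ (Adj-sym sb)
    ... | inj₁ s∈ = s∉ s∈
    ... | inj₂ ¬Ps = ¬Ps Ps

module Rotation {G : Graph} (R : RotationSystem G) where
  open Graph G renaming (sym to Adj-sym)
  open RotationSystem R

  deg≡degree : ∀ v → deg v ≡ degree G v
  deg≡degree v = cantor-schröder-bernstein position-injective rotationIndex-injective
    where
    neighbours : List (Fin n)
    neighbours = filter (Adj-dec v) (allFin n)

    rotated∈ : ∀ i → rot v i ∈ neighbours
    rotated∈ i = ∈-filter⁺ (Adj-dec v) (∈-allFin (rot v i)) (rot-adj v i)

    position : Fin (deg v) → Fin (length neighbours)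
    position i = index (rotated∈ i)

    position-injective : Injective _≡_ _≡_ position
    position-injective eq = rot-inj v (index-injective (setoid (Fin n)) (rotated∈ _) (rotated∈ _) eq)

    rotated : ∀ k → ∃ λ i → rot v i ≡ lookup neighbours k
    rotated k = rot-sur v _ (proj₂ (∈-filter⁻ (Adj-dec v) {xs = allFin n} (∈-lookup k)))

    rotationIndex : Fin (length neighbours) → Fin (deg v)
    rotationIndex k = proj₁ (rotated k)

    rotationIndex-injective : Injective _≡_ _≡_ rotationIndex
    rotationIndex-injective {k} {l} eq = lookup-injective (filter⁺ (Adj-dec v) (allFin⁺ n))
      (trans (sym (proj₂ (rotated k))) (trans (cong (rot v) eq) (proj₂ (rotated l))))

  -- the face traced through u → v continues to w
  Next : Fin n → Fin n → Fin n → Set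
  Next v u w = ∃ λ i → rot v i ≡ u × rot v (csuc i) ≡ w

  module _ {v : Fin n} where

    Next⇒Adjˡ : ∀ {u w} → Next v u w → Adj v u
    Next⇒Adjˡ (i , refl , _) = rot-adj v i

    Next⇒Adjʳ : ∀ {u w} → Next v u w → Adj v w
    Next⇒Adjʳ (i , _ , refl) = rot-adj v (csuc i)

    next-total : ∀ {u} → Adj v u → ∃ (Next v u)
    next-total vu with rot-sur v _ vu
    ... | i , ri≡u = rot v (csuc i) , i , ri≡u , refl

    next-unique : ∀ {u w w′} → Next v u w → Next v u w′ → w ≡ w′
    next-unique (i , refl , refl) (j , rj≡ri , refl) with rot-inj v rj≡ri
    ... | refl = refl

    module _ (deg≡3 : deg v ≡ 3) where

      next-irreflexive : ∀ {u w} → Next v u w → u ≢ w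
      next-irreflexive (i , refl , refl) eq = csuc-fixfree₃ deg≡3 i (rot-inj v (sym eq))

      next-cycle : ∀ {u w t} → Next v u w → Next v w t → Next v t u
      next-cycle (i , refl , refl) (j , rj≡ , refl) with rot-inj v rj≡
      ... | refl = csuc j , refl , cong (rot v) (csuc³≡id deg≡3 i)

      next-cover : ∀ {u w t s} → Next v u w → Next v w t → Adj v s → s ≡ u ⊎ s ≡ w ⊎ s ≡ t
      next-cover (i , refl , refl) (j , rj≡ , refl) vs with rot-inj v rj≡ | rot-sur v _ vs
      ... | refl | l , refl with csuc-orbit₃ deg≡3 i l
      ...   | inj₁ refl = inj₁ refl
      ...   | inj₂ (inj₁ refl) = inj₂ (inj₁ refl)
      ...   | inj₂ (inj₂ refl) = inj₂ (inj₂ refl)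

    module _ (deg≡2 : deg v ≡ 2) where

      next-symmetric : ∀ {u w} → Next v u w → Next v w u
      next-symmetric (i , refl , refl) = csuc i , refl , cong (rot v) (csuc²≡id deg≡2 i)

      next-cover₂ : ∀ {u w s} → Next v u w → Adj v s → s ≡ u ⊎ s ≡ w
      next-cover₂ (i , refl , refl) vs with rot-sur v _ vs
      ... | l , refl with csuc-orbit₂ deg≡2 i l
      ...   | inj₁ refl = inj₁ refl
      ...   | inj₂ refl = inj₂ refl

  faceVertex : Dart → ℕ → Fin n
  faceVertex d k = tail (φ^ k d)

  next-faceVertex : ∀ d k → Next (faceVertex d (suc k)) (faceVertex d k) (faceVertex d (2 + k))
  next-faceVertex (v , i) zero = rev v i , rev-ok v i , refl
  next-faceVertex d (suc k) = next-faceVertex (φ d) k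

  next-along : ∀ d k {u v w} → faceVertex d k ≡ u → faceVertex d (suc k) ≡ v →
               faceVertex d (2 + k) ≡ w → Next v u w
  next-along d k refl refl refl = next-faceVertex d k

  φ^-+ : ∀ j k d → φ^ (j + k) d ≡ φ^ k (φ^ j d)
  φ^-+ zero k d = refl
  φ^-+ (suc j) k d = φ^-+ j k (φ d)

  faceVertex-periodic : ∀ j {d} → φ^ j d ≡ d → ∀ k → faceVertex d (j + k) ≡ faceVertex d k
  faceVertex-periodic j {d} φʲd≡d k = cong tail (trans (φ^-+ j k d) (cong (φ^ k) φʲd≡d))

  dart-from : ∀ {u v} → Adj u v → Σ Dart λ d → faceVertex d 0 ≡ u × faceVertex d 1 ≡ v
  dart-from {u} uv with rot-sur u _ uv
  ... | i , ri≡v = (u , i) , refl , ri≡v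

module Ladders {G : Graph} (R : RotationSystem G)
               (2-connected : TwoConnected G) (faces≤6 : ∀ d → RotationSystem.FaceSize≤ R d 6)
               (x y : Fin (Graph.n G))
               (cubic : ∀ v → v ≢ x → v ≢ y → degree G v ≡ 3) where
  open Graph G renaming (sym to Adj-sym)
  open RotationSystem R
  open Rotation R

  record Ladder : Set where
    field
      inside   : List (Fin n)
      unique   : Unique inside
      x∈       : x ∈ inside
      y∈       : y ∈ inside
      a b c e  : Fin n
      a∈       : a ∈ inside
      b∈       : b ∈ inside
      c∉       : c ∉ inside
      e∉       : e ∉ inside
      c≢e      : c ≢ e
      closed   : ∀ {t u} → t ∈ inside → Adj t u → u ∈ inside ⊎ (t ≡ a × u ≡ e) ⊎ (t ≡ b × u ≡ c)
      next-bca : Next b c a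
      next-abe : Next a b e
      next-cbe : Next c b e
      next-eca : Next e c a

  size : Ladder → ℕ
  size L = length (Ladder.inside L)

  size≤n : ∀ L → size L ≤ n
  size≤n L = injective⇒≤ (lookup-injective (Ladder.unique L))

  module Grow (L : Ladder) where
    open Ladder L

    outside-cubic : ∀ {v} → v ∉ inside → deg v ≡ 3
    outside-cubic v∉ = trans (deg≡degree _) (cubic _ (∉⇒≢ v∉ x∈) (∉⇒≢ v∉ y∈))

    leaving⇒rail : ∀ {t u} → t ∈ inside → u ∉ inside → Adj t u → (t ≡ a × u ≡ e) ⊎ (t ≡ b × u ≡ c)
    leaving⇒rail t∈ u∉ tu with closed t∈ tu
    ... | inj₁ u∈ = contradiction u∈ u∉
    ... | inj₂ rail = rail

    deg-c : deg c ≡ 3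
    deg-c = outside-cubic c∉

    deg-e : deg e ≡ 3
    deg-e = outside-cubic e∉

    dart-cb : Σ Dart λ d → faceVertex d 0 ≡ c × faceVertex d 1 ≡ b
    dart-cb = dart-from (Adj-sym (Next⇒Adjˡ next-bca))

    p : Dart
    p = proj₁ dart-cb

    p₀≡c : faceVertex p 0 ≡ c
    p₀≡c = proj₁ (proj₂ dart-cb)

    p₁≡b : faceVertex p 1 ≡ b
    p₁≡b = proj₂ (proj₂ dart-cb)

    p₂≡a : faceVertex p 2 ≡ a
    p₂≡a = next-unique (next-along p 0 p₀≡c p₁≡b refl) next-bca

    p₃≡e : faceVertex p 3 ≡ e
    p₃≡e = next-unique (next-along p 1 p₁≡b p₂≡a refl) next-abe

    f g : Fin n
    f = faceVertex p 4
    g = faceVertex p 5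

    next-eaf : Next e a f
    next-eaf = next-along p 2 p₂≡a p₃≡e refl

    next-feg : Next f e g
    next-feg = next-along p 3 p₃≡e refl refl

    next-efc : Next e f c
    next-efc = next-cycle deg-e next-eca next-eaf

    f≢c : f ≢ c
    f≢c = next-irreflexive deg-e next-efc

    f≢e : f ≢ e
    f≢e f≡e = Adj⇒≢ G (Next⇒Adjʳ next-eaf) (sym f≡e)

    f∉ : f ∉ inside
    f∉ f∈ with leaving⇒rail f∈ e∉ (Adj-sym (Next⇒Adjʳ next-eaf))
    ... | inj₁ (f≡a , _) = next-irreflexive deg-e next-eaf (sym f≡a)
    ... | inj₂ (_ , e≡c) = c≢e (sym e≡c)

    deg-f : deg f ≡ 3
    deg-f = outside-cubic f∉

    grown-closed : ∀ {u} → Next c u b → ∀ {t w} → t ∈ c ∷ e ∷ inside → Adj t w →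
                   w ∈ c ∷ e ∷ inside ⊎ (t ≡ c × w ≡ u) ⊎ (t ≡ e × w ≡ f)
    grown-closed next-cub (here refl) cw with next-cover deg-c next-cub next-cbe cw
    ... | inj₁ w≡u = inj₂ (inj₁ (refl , w≡u))
    ... | inj₂ (inj₁ refl) = inj₁ (there (there b∈))
    ... | inj₂ (inj₂ refl) = inj₁ (there (here refl))
    grown-closed _ (there (here refl)) ew with next-cover deg-e next-eca next-eaf ew
    ... | inj₁ refl = inj₁ (here refl)
    ... | inj₂ (inj₁ refl) = inj₁ (there (there a∈))
    ... | inj₂ (inj₂ w≡f) = inj₂ (inj₂ (refl , w≡f))
    grown-closed _ (there (there t∈)) tw with closed t∈ tw
    ... | inj₁ w∈ = inj₁ (there (there w∈))
    ... | inj₂ (inj₁ (_ , refl)) = inj₁ (there (here refl))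
    ... | inj₂ (inj₂ (_ , refl)) = inj₁ (here refl)

    pentagon-impossible : faceVertex p 5 ≡ c → faceVertex p 6 ≡ b → ⊥
    pentagon-impossible g≡c p₆≡b =
      closed⇒¬WalkIn G avoids-f h∉ (there (there x∈))
        (proj₂ (proj₂ 2-connected) f h x h≢f (∉⇒≢ f∉ x∈ ∘ sym))
      where
      next-fec : Next f e c
      next-fec = subst (Next f e) g≡c next-feg

      h : Fin n
      h = proj₁ (next-total (Next⇒Adjʳ next-fec))

      next-fch : Next f c h
      next-fch = proj₂ (next-total (Next⇒Adjʳ next-fec))

      h≢f : h ≢ f
      h≢f h≡f = Adj⇒≢ G (Next⇒Adjʳ next-fch) (sym h≡f)

      h∉ : h ∉ c ∷ e ∷ inside
      h∉ (here h≡c) = next-irreflexive deg-f next-fch (sym h≡c)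
      h∉ (there (here h≡e)) = next-irreflexive deg-f (next-cycle deg-f next-fec next-fch) h≡e
      h∉ (there (there h∈)) with leaving⇒rail h∈ f∉ (Adj-sym (Next⇒Adjʳ next-fch))
      ... | inj₁ (_ , f≡e) = f≢e f≡e
      ... | inj₂ (_ , f≡c) = f≢c f≡c

      avoids-f : ∀ {t w} → t ∈ c ∷ e ∷ inside → Adj t w → w ∈ c ∷ e ∷ inside ⊎ ¬ (w ≢ f)
      avoids-f t∈ tw with grown-closed (next-along p 4 refl g≡c p₆≡b) t∈ tw
      ... | inj₁ w∈ = inj₁ w∈
      ... | inj₂ (inj₁ (_ , w≡f)) = inj₂ λ w≢f → w≢f w≡f
      ... | inj₂ (inj₂ (_ , w≡f)) = inj₂ λ w≢f → w≢f w≡f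

    hexagon-grows : faceVertex p 6 ≡ c → faceVertex p 7 ≡ b → Σ Ladder λ L′ → size L < size L′
    hexagon-grows p₆≡c p₇≡b = grown , s≤s (n≤1+n _)
      where
      next-cgb : Next c g b
      next-cgb = next-along p 5 refl p₆≡c p₇≡b

      f∉′ : f ∉ c ∷ e ∷ inside
      f∉′ (here f≡c) = f≢c f≡c
      f∉′ (there (here f≡e)) = f≢e f≡e
      f∉′ (there (there f∈)) = f∉ f∈

      g∉′ : g ∉ c ∷ e ∷ inside
      g∉′ (here g≡c) = Adj⇒≢ G (Next⇒Adjˡ next-cgb) (sym g≡c)
      g∉′ (there (here g≡e)) = next-irreflexive deg-f next-feg (sym g≡e)
      g∉′ (there (there g∈)) with leaving⇒rail g∈ c∉ (Adj-sym (Next⇒Adjˡ next-cgb))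
      ... | inj₁ (_ , c≡e) = c≢e c≡e
      ... | inj₂ (g≡b , _) = next-irreflexive deg-c next-cgb g≡b

      grown : Ladder
      grown = record
        { inside   = c ∷ e ∷ inside
        ; unique   = (c≢e All.∷ ¬Any⇒All¬ _ c∉) ∷ ¬Any⇒All¬ _ e∉ ∷ unique
        ; x∈       = there (there x∈)
        ; y∈       = there (there y∈)
        ; a = c ; b = e ; c = f ; e = g
        ; a∈       = here refl
        ; b∈       = there (here refl)
        ; c∉       = f∉′
        ; e∉       = g∉′
        ; c≢e      = Adj⇒≢ G (Next⇒Adjʳ next-feg)
        ; closed   = grown-closed next-cgb
        ; next-bca = next-efc
        ; next-abe = next-cycle deg-c next-cgb next-cbe
        ; next-cbe = next-feg
        ; next-eca = next-along p 4 refl refl p₆≡c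
        }

    by-face-size : ∀ j → 1 ≤ j → j ≤ 6 → faceVertex p (j + 0) ≡ c → faceVertex p (j + 1) ≡ b →
                   Σ Ladder λ L′ → size L < size L′
    by-face-size 0 () _ _ _
    by-face-size 1 _ _ p₁≡c _ = ⊥-elim (∉⇒≢ c∉ b∈ (trans (sym p₁≡c) p₁≡b))
    by-face-size 2 _ _ p₂≡c _ = ⊥-elim (∉⇒≢ c∉ a∈ (trans (sym p₂≡c) p₂≡a))
    by-face-size 3 _ _ p₃≡c _ = ⊥-elim (c≢e (trans (sym p₃≡c) p₃≡e))
    by-face-size 4 _ _ p₄≡c _ = ⊥-elim (f≢c p₄≡c)
    by-face-size 5 _ _ p₅≡c p₆≡b = ⊥-elim (pentagon-impossible p₅≡c p₆≡b)
    by-face-size 6 _ _ p₆≡c p₇≡b = hexagon-grows p₆≡c p₇≡b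
    by-face-size (suc (suc (suc (suc (suc (suc (suc _))))))) _ (s≤s (s≤s (s≤s (s≤s (s≤s (s≤s ())))))) _ _

    grow : Σ Ladder λ L′ → size L < size L′
    grow with faces≤6 p
    ... | j , 1≤j , j≤6 , φʲp≡p = by-face-size j 1≤j j≤6
      (trans (faceVertex-periodic j φʲp≡p 0) p₀≡c) (trans (faceVertex-periodic j φʲp≡p 1) p₁≡b)

  arbitrarily-large : Ladder → ∀ k → Σ Ladder λ L → k ≤ size L
  arbitrarily-large L₀ zero = L₀ , z≤n
  arbitrarily-large L₀ (suc k) with arbitrarily-large L₀ k
  ... | L , k≤size with Grow.grow L
  ...   | L′ , size<size′ = L′ , ≤-<-trans k≤size size<size′

  no-ladder : ¬ Ladder
  no-ladder L₀ with arbitrarily-large L₀ (suc n)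
  ... | L , n<size = <⇒≱ n<size (size≤n L)

  outer-ladder : ∀ d {z w} → φ^ 4 d ≡ d →
                 faceVertex d 0 ≡ x → faceVertex d 1 ≡ y → faceVertex d 2 ≡ z → faceVertex d 3 ≡ w →
                 x ≢ y → x ≢ z → x ≢ w → y ≢ z → y ≢ w → z ≢ w →
                 degree G x ≡ 2 → degree G y ≡ 2 → Ladder
  outer-ladder d {z} {w} φ⁴d≡d d₀≡x d₁≡y d₂≡z d₃≡w x≢y x≢z x≢w y≢z y≢w z≢w degree-x degree-y = record
    { inside   = x ∷ y ∷ []
    ; unique   = (x≢y All.∷ All.[]) ∷ All.[] ∷ []
    ; x∈       = here refl
    ; y∈       = there (here refl)
    ; a = x ; b = y ; c = z ; e = w
    ; a∈       = here refl
    ; b∈       = there (here refl)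
    ; c∉       = λ { (here z≡x) → x≢z (sym z≡x) ; (there (here z≡y)) → y≢z (sym z≡y) }
    ; e∉       = λ { (here w≡x) → x≢w (sym w≡x) ; (there (here w≡y)) → y≢w (sym w≡y) }
    ; c≢e      = z≢w
    ; closed   = closed
    ; next-bca = next-symmetric deg-y next-yxz
    ; next-abe = next-symmetric deg-x next-xwy
    ; next-cbe = next-along d 1 d₁≡y d₂≡z d₃≡w
    ; next-eca = next-along d 2 d₂≡z d₃≡w d₄≡x
    }
    where
    deg-x : deg x ≡ 2
    deg-x = trans (deg≡degree x) degree-x

    deg-y : deg y ≡ 2
    deg-y = trans (deg≡degree y) degree-y

    d₄≡x : faceVertex d 4 ≡ x
    d₄≡x = trans (faceVertex-periodic 4 φ⁴d≡d 0) d₀≡x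

    next-yxz : Next y x z
    next-yxz = next-along d 0 d₀≡x d₁≡y d₂≡z

    next-xwy : Next x w y
    next-xwy = next-along d 3 d₃≡w d₄≡x (trans (faceVertex-periodic 4 φ⁴d≡d 1) d₁≡y)

    closed : ∀ {t u} → t ∈ x ∷ y ∷ [] → Adj t u → u ∈ x ∷ y ∷ [] ⊎ (t ≡ x × u ≡ w) ⊎ (t ≡ y × u ≡ z)
    closed (here refl) xu with next-cover₂ deg-x next-xwy xu
    ... | inj₁ u≡w = inj₂ (inj₁ (refl , u≡w))
    ... | inj₂ u≡y = inj₁ (there (here u≡y))
    closed (there (here refl)) yu with next-cover₂ deg-y next-yxz yu
    ... | inj₁ u≡x = inj₁ (here u≡x)
    ... | inj₂ u≡z = inj₂ (inj₂ (refl , u≡z))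

lemma7 : ¬ (Σ Graph λ G → Σ (RotationSystem G) λ R →
           let open Graph G
               open RotationSystem R
           in Planar × TwoConnected G × (∀ d → FaceSize≤ d 6)
              × (Σ Dart λ d → Σ (Fin n) λ x → Σ (Fin n) λ y → Σ (Fin n) λ z → Σ (Fin n) λ w →
                   (φ^ 4 d ≡ d)
                   × (tail d ≡ x) × (tail (φ^ 1 d) ≡ y) × (tail (φ^ 2 d) ≡ z) × (tail (φ^ 3 d) ≡ w)
                   × (x ≢ y) × (x ≢ z) × (x ≢ w) × (y ≢ z) × (y ≢ w) × (z ≢ w)
                   × (degree G x ≡ 2) × (degree G y ≡ 2)
                   × (∀ v → v ≢ x → v ≢ y → degree G v ≡ 3)))
lemma7 (G , R , _ , 2-connected , faces≤6 , d , x , y , z , w , φ⁴d≡d , d₀≡x , d₁≡y , d₂≡z , d₃≡w ,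
        x≢y , x≢z , x≢w , y≢z , y≢w , z≢w , degree-x , degree-y , cubic) =
  no-ladder (outer-ladder d φ⁴d≡d d₀≡x d₁≡y d₂≡z d₃≡w x≢y x≢z x≢w y≢z y≢w z≢w degree-x degree-y)
  where open Ladders R 2-connected faces≤6 x y cubic
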